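{- Let $k\geq 2$ and $n\geq 1$ be integers. Then $$e^{(k)}_{n}=\sum_{j=1}^{k-1}\left(j\sum_{i=k-1}^{n+k-1-j}F_{i}^{(k)}F_{n+2k-2-j-i}^{(k)}\right).$$
   Context: For $n\geq 1$ and $k\geq 2$, the hypercube $Q_n$ is the graph whose vertices are the binary strings of length $n$, two strings adjacent iff they differ in exactly one coordinate. The $k$-th order Fibonacci cube $\Gamma^{(k)}_n$ is the subgraph of $Q_n$ induced by the binary strings of length $n$ that do not contain $k$ consecutive 1s (i.e. do not contain $1^k$ as a factor); $\Gamma^{(k)}_0$ is the one-vertex graph. Let $e^{(k)}_n=|E(\Gamma^{(k)}_n)|$ denote its number of edges. The $k$-th order Fibonacci numbers are defined by $F_0^{(k)}=\cdots=F_{k-2}^{(k)}=0$, $F_{k-1}^{(k)}=1$, and $F_n^{(k)}=F_{n-1}^{(k)}+F_{n-2}^{(k)}+\cdots+F_{n-k}^{(k)}$ for $n\geq k$. -}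

module Defs where

open import Data.Nat using (ℕ; zero; suc; _+_; _*_; _∸_; _≤ᵇ_)
open import Data.Bool using (Bool; true; false; _∨_; not; if_then_else_; _xor_)
import Data.Bool.Properties as BP
open import Data.Vec using (Vec; []; _∷_)
open import Data.List using (List; []; _∷_; map; _++_; length; filter)
open import Data.Product using (_×_; _,_; proj₁; proj₂)
open import Data.Nat.Properties using (_≟_)
open import Relation.Binary.PropositionalEquality using (_≡_)

allStrings : (n : ℕ) → List (Vec Bool n)
allStrings zero = [] ∷ []
allStrings (suc n) = map (false ∷_) (allStrings n) ++ map (true ∷_) (allStrings n)

-- hasRun k c xs : does (1^c followed by xs) contain 1^k as a factor?
hasRun : ℕ → ℕ → {n : ℕ} → Vec Bool n → Bool
hasRun k c [] = k ≤ᵇ c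
hasRun k c (false ∷ xs) = (k ≤ᵇ c) ∨ hasRun k 0 xs
hasRun k c (true ∷ xs) = (k ≤ᵇ c) ∨ hasRun k (suc c) xs

-- string avoids 1^k as a factor (intended for k ≥ 1)
avoids1^ : (k : ℕ) → {n : ℕ} → Vec Bool n → Bool
avoids1^ k xs = not (hasRun k 0 xs)

fibVertices : (k n : ℕ) → List (Vec Bool n)
fibVertices k n = filter (λ v → avoids1^ k v BP.≟ true) (allStrings n)

hamming : {n : ℕ} → Vec Bool n → Vec Bool n → ℕ
hamming [] [] = 0
hamming (x ∷ xs) (y ∷ ys) = (if x xor y then 1 else 0) + hamming xs ys

pairs : {A : Set} → List A → List (A × A)
pairs [] = []
pairs (x ∷ xs) = map (x ,_) xs ++ pairs xs

-- e^(k)_n : number of edges of Γ^(k)_n, the subgraph of Q_n induced by fibVertices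
edgeCount : (k n : ℕ) → ℕ
edgeCount k n = length (filter (λ p → hamming (proj₁ p) (proj₂ p) ≟ 1) (pairs (fibVertices k n)))

-- k-th order Fibonacci numbers: F_0 = … = F_{k-2} = 0, F_{k-1} = 1,
-- F_n = F_{n-1} + … + F_{n-k} for n ≥ k.
-- fibSeq k n = list [F_{n-1}, F_{n-2}, …, F_0] (most recent first)
private
  sumFirst : ℕ → List ℕ → ℕ
  sumFirst zero _ = 0
  sumFirst (suc m) [] = 0
  sumFirst (suc m) (x ∷ xs) = x + sumFirst m xs

  nextF : ℕ → ℕ → List ℕ → ℕ
  nextF k n prev = if (suc n) ≤ᵇ k then (if (suc n Data.Nat.≡ᵇ k) then 1 else 0) else sumFirst k prev

  hist : ℕ → ℕ → List ℕ
  hist k zero = []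
  hist k (suc n) = nextF k n (hist k n) ∷ hist k n

F : (k n : ℕ) → ℕ
F k n = nextF k n (hist k n)

-- Σ_{i=a}^{b} f i  (empty, i.e. 0, when b < a)
Σ[_⋯_] : ℕ → ℕ → (ℕ → ℕ) → ℕ
Σ[ a ⋯ b ] f = go (suc b ∸ a) a
  where
  go : ℕ → ℕ → ℕ
  go zero i = 0
  go (suc m) i = f i + go m (suc i)

-- Let V_c(m) be the set of strings v of length m such that 1^c v has no factor 1^k (so V_0(m) is the
-- vertex set of Γ^(k)_m), N_c(m) its size and E_c(m) the number of edges it induces in Q_m. For c < k,
-- V_c(m+1) = 0·V_0(m) ∪ 1·V_{c+1}(m), and since V_{c+1}(m) ⊆ V_0(m) the edges between the two halves
-- are exactly the pairs {0v, 1v} with v ∈ V_{c+1}(m). Hence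
--   N_c(m+1) = N_0(m) + N_{c+1}(m),   E_c(m+1) = E_0(m) + E_{c+1}(m) + N_{c+1}(m),
-- with N_k = E_k = 0, N_c(0) = 1 and E_c(0) = 0. This system has only one solution. In terms of
-- generating functions, with H = Σ_m F_{m+k-1} x^m = 1/(1 - x - ⋯ - x^k), it is
--   N_c = (1 + x + ⋯ + x^{k-c-1}) H,   E_c = (Σ_{j<k-c} j x^j) H + (x + ⋯ + x^{k-c}) R,
-- where R = (Σ_{j<k} j x^j) H² satisfies R = (Σ_{j<k} j x^j) H + (x + ⋯ + x^k) R. In particular
-- E_0 = R, whose coefficient of x^n is the right-hand side.

module Submission where

open import Defs
open import Data.Bool using (Bool; true; false; not; _∧_; _∨_; T)
import Data.Bool.Properties as Bool
open import Data.Empty using (⊥-elim)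
open import Data.Fin using (Fin; zero; suc; toℕ)
open import Data.Fin.Properties using (toℕ<n)
open import Data.List using (List; []; _∷_; map; _++_; length; filter)
open import Data.List.Properties using (length-++; length-map; filter-++; filter-≐; filter-none)
open import Data.List.Relation.Unary.All using (universal)
open import Data.Nat
open import Data.Nat.Properties
open import Data.Nat.Tactic.RingSolver using (solve-∀)
open import Data.Product using (_,_; proj₁; proj₂)
open import Data.Sum as Sum using (inj₁; inj₂)
open import Data.Vec using (Vec; []; _∷_)
open import Function.Base using (_∘_; id; _∋_)
open import Function.Bundles using (Equivalence)
open import Level using (Level)
open import Relation.Binary.PropositionalEquality
open import Relation.Nullary using (does; yes; no)
open import Relation.Nullary.Decidable using (dec-true; dec-false)
open import Relation.Unary using (Pred; Decidable)

open import Algebra.Properties.CommutativeSemigroup +-commutativeSemigroup using () renaming (interchange to +-interchange)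
open import Algebra.Properties.Semiring.Sum +-*-semiring

private variable
  a ℓ : Level
  A B : Set a
  m : ℕ

-- Sequences as power series

-- shift a f has generating function x^a times that of f.
shift : ℕ → (ℕ → ℕ) → ℕ → ℕ
shift zero    f m       = f m
shift (suc a) f zero    = 0
shift (suc a) f (suc m) = shift a f m

shift-cong : ∀ a {f g} → f ≗ g → shift a f ≗ shift a g
shift-cong zero    f≗g m       = f≗g m
shift-cong (suc a) f≗g zero    = refl
shift-cong (suc a) f≗g (suc m) = shift-cong a f≗g m

shift-zero : ∀ a → shift a (λ _ → 0) ≗ λ _ → 0
shift-zero zero    m       = refl
shift-zero (suc a) zero    = refl
shift-zero (suc a) (suc m) = shift-zero a m

shift-+ : ∀ a f g m → shift a (λ x → f x + g x) m ≡ shift a f m + shift a g m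
shift-+ zero    f g m       = refl
shift-+ (suc a) f g zero    = refl
shift-+ (suc a) f g (suc m) = shift-+ a f g m

shift-*ˡ : ∀ a c f m → shift a (λ x → c * f x) m ≡ c * shift a f m
shift-*ˡ zero    c f m       = refl
shift-*ˡ (suc a) c f zero    = sym (*-zeroʳ c)
shift-*ˡ (suc a) c f (suc m) = shift-*ˡ a c f m

shift-∑ : ∀ a {n} (G : Fin n → ℕ → ℕ) m → shift a (λ x → ∑[ i < n ] G i x) m ≡ ∑[ i < n ] shift a (G i) m
shift-∑ zero        G m       = refl
shift-∑ (suc a) {n} G zero    = sym (sum-replicate-zero n)
shift-∑ (suc a)     G (suc m) = shift-∑ a G m

shift-shift : ∀ a b f → shift a (shift b f) ≗ shift (a + b) f
shift-shift zero    b f m       = refl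
shift-shift (suc a) b f zero    = refl
shift-shift (suc a) b f (suc m) = shift-shift a b f m

shift-comm : ∀ a b f m → shift a (shift b f) m ≡ shift b (shift a f) m
shift-comm a b f m = begin
  shift a (shift b f) m  ≡⟨ shift-shift a b f m ⟩
  shift (a + b) f m      ≡⟨ cong (λ s → shift s f m) (+-comm a b) ⟩
  shift (b + a) f m      ≡⟨ shift-shift b a f m ⟨
  shift b (shift a f) m  ∎
  where open ≡-Reasoning

shift-at : ∀ a f p → shift a f (a + p) ≡ f p
shift-at zero    f p = refl
shift-at (suc a) f p = shift-at a f p

shift-below : ∀ a f {m} → m < a → shift a f m ≡ 0
shift-below (suc a) f {zero}  _         = refl
shift-below (suc a) f {suc m} (s≤s m<a) = shift-below a f m<a

shift-vanishes : ∀ {c} g → (∀ i → i < c → g i ≡ 0) → ∀ a i → i < c → shift a g i ≡ 0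
shift-vanishes g g<c zero    i       i<c = g<c i i<c
shift-vanishes g g<c (suc a) zero    i<c = refl
shift-vanishes g g<c (suc a) (suc i) i<c = shift-vanishes g g<c a i (<-trans (n<1+n i) i<c)

shift-offset : ∀ a {c} g → (∀ i → i < c → g i ≡ 0) → ∀ m → shift a g (m + c) ≡ shift a (λ x → g (x + c)) m
shift-offset zero            g g<c m       = refl
shift-offset (suc a)         g g<c (suc m) = shift-offset a g g<c m
shift-offset (suc a) {zero}  g g<c zero    = refl
shift-offset (suc a) {suc c} g g<c zero    = shift-vanishes g g<c a c (n<1+n c)

precedingSum : ℕ → (ℕ → ℕ) → ℕ → ℕ
precedingSum L f m = ∑[ a < L ] shift (suc (toℕ a)) f m

weighted : ℕ → (ℕ → ℕ) → ℕ → ℕ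
weighted L f m = ∑[ j < L ] (toℕ j * shift (toℕ j) f m)

weighted-at-zero : ∀ L f → weighted L f 0 ≡ 0
weighted-at-zero L f = trans (sum-cong-≗ {L} (λ j → term (toℕ j))) (sum-replicate-zero L)
  where
  term : ∀ j → j * shift j f 0 ≡ 0
  term zero    = refl
  term (suc j) = *-zeroʳ (suc j)

_⋆_ : (ℕ → ℕ) → (ℕ → ℕ) → ℕ → ℕ
(f ⋆ g) p = ∑[ i < suc p ] (f (toℕ i) * g (p ∸ toℕ i))

δ : ℕ → ℕ
δ zero    = 1
δ (suc _) = 0

δ-⋆ : ∀ h → δ ⋆ h ≗ h
δ-⋆ h p = trans (cong₂ _+_ (*-identityˡ (h p)) (sum-replicate-zero p)) (+-identityʳ (h p))

record IsShiftLinear (Φ : (ℕ → ℕ) → ℕ → ℕ) : Set where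
  field
    cong-≗     : ∀ {f g} → f ≗ g → Φ f ≗ Φ g
    zero-homo  : Φ (λ _ → 0) ≗ λ _ → 0
    +-homo     : ∀ f g → Φ (λ x → f x + g x) ≗ λ m → Φ f m + Φ g m
    shift-homo : ∀ a f → Φ (shift a f) ≗ shift a (Φ f)

  ∑-homo : ∀ {n} (G : Fin n → ℕ → ℕ) → Φ (λ x → ∑[ i < n ] G i x) ≗ λ m → ∑[ i < n ] Φ (G i) m
  ∑-homo {zero}  G   = zero-homo
  ∑-homo {suc n} G m = trans (+-homo (G zero) (λ x → ∑[ i < n ] G (suc i) x) m)
                             (cong (Φ (G zero) m +_) (∑-homo (λ i → G (suc i)) m))

  precedingSum-homo : ∀ L f → Φ (precedingSum L f) ≗ precedingSum L (Φ f)
  precedingSum-homo L f m = trans (∑-homo {L} (λ a → shift (suc (toℕ a)) f) m)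
                                  (sum-cong-≗ {L} (λ a → shift-homo (suc (toℕ a)) f m))

  recurrence-homo : ∀ L {f g} → f ≗ (λ m → g m + precedingSum L f m) →
                    Φ f ≗ λ m → Φ g m + precedingSum L (Φ f) m
  recurrence-homo L {f} {g} f≗ m = begin
    Φ f m                                 ≡⟨ cong-≗ f≗ m ⟩
    Φ (λ x → g x + precedingSum L f x) m  ≡⟨ +-homo g (precedingSum L f) m ⟩
    Φ g m + Φ (precedingSum L f) m        ≡⟨ cong (Φ g m +_) (precedingSum-homo L f m) ⟩
    Φ g m + precedingSum L (Φ f) m        ∎
    where open ≡-Reasoning

⋆-isShiftLinear : ∀ h → IsShiftLinear (_⋆ h)
⋆-isShiftLinear h = record
  { cong-≗     = λ f≗g p → sum-cong-≗ {suc p} (λ i → cong (_* h (p ∸ toℕ i)) (f≗g (toℕ i)))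
  ; zero-homo  = λ p → sum-replicate-zero (suc p)
  ; +-homo     = ⋆-+
  ; shift-homo = shift-⋆
  }
  where
  ⋆-+ : ∀ f g → ((λ x → f x + g x) ⋆ h) ≗ λ p → (f ⋆ h) p + (g ⋆ h) p
  ⋆-+ f g p = trans (sum-cong-≗ {suc p} (λ i → *-distribʳ-+ (h (p ∸ toℕ i)) (f (toℕ i)) (g (toℕ i))))
                    (∑-distrib-+ {suc p} (λ i → f (toℕ i) * h (p ∸ toℕ i)) (λ i → g (toℕ i) * h (p ∸ toℕ i)))

  shift-⋆ : ∀ a f → (shift a f ⋆ h) ≗ shift a (f ⋆ h)
  shift-⋆ zero    f p       = refl
  shift-⋆ (suc a) f zero    = refl
  shift-⋆ (suc a) f (suc p) = shift-⋆ a f p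

weighted-isShiftLinear : ∀ L → IsShiftLinear (weighted L)
weighted-isShiftLinear L = record
  { cong-≗     = λ f≗g m → sum-cong-≗ {L} (λ j → cong (toℕ j *_) (shift-cong (toℕ j) f≗g m))
  ; zero-homo  = weighted-zero
  ; +-homo     = weighted-+
  ; shift-homo = weighted-shift
  }
  where
  open ≡-Reasoning

  weighted-zero : weighted L (λ _ → 0) ≗ λ _ → 0
  weighted-zero m = begin
    ∑[ j < L ] (toℕ j * shift (toℕ j) (λ _ → 0) m)  ≡⟨ sum-cong-≗ {L} (λ j → cong (toℕ j *_) (shift-zero (toℕ j) m)) ⟩
    ∑[ j < L ] (toℕ j * 0)                           ≡⟨ sum-cong-≗ {L} (λ j → *-zeroʳ (toℕ j)) ⟩
    ∑[ j < L ] 0                                     ≡⟨ sum-replicate-zero L ⟩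
    0                                                ∎

  weighted-+ : ∀ f g → weighted L (λ x → f x + g x) ≗ λ m → weighted L f m + weighted L g m
  weighted-+ f g m = begin
    ∑[ j < L ] (toℕ j * shift (toℕ j) (λ x → f x + g x) m)
      ≡⟨ sum-cong-≗ {L} (λ j → cong (toℕ j *_) (shift-+ (toℕ j) f g m)) ⟩
    ∑[ j < L ] (toℕ j * (shift (toℕ j) f m + shift (toℕ j) g m))
      ≡⟨ sum-cong-≗ {L} (λ j → *-distribˡ-+ (toℕ j) (shift (toℕ j) f m) (shift (toℕ j) g m)) ⟩
    ∑[ j < L ] (toℕ j * shift (toℕ j) f m + toℕ j * shift (toℕ j) g m)
      ≡⟨ ∑-distrib-+ {L} (λ j → toℕ j * shift (toℕ j) f m) (λ j → toℕ j * shift (toℕ j) g m) ⟩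
    weighted L f m + weighted L g m
      ∎

  weighted-shift : ∀ a f → weighted L (shift a f) ≗ shift a (weighted L f)
  weighted-shift a f m = begin
    ∑[ j < L ] (toℕ j * shift (toℕ j) (shift a f) m)
      ≡⟨ sum-cong-≗ {L} (λ j → cong (toℕ j *_) (shift-comm (toℕ j) a f m)) ⟩
    ∑[ j < L ] (toℕ j * shift a (shift (toℕ j) f) m)
      ≡⟨ sum-cong-≗ {L} (λ j → shift-*ˡ a (toℕ j) (shift (toℕ j) f) m) ⟨
    ∑[ j < L ] shift a (λ x → toℕ j * shift (toℕ j) f x) m
      ≡⟨ shift-∑ a {L} (λ j x → toℕ j * shift (toℕ j) f x) m ⟨
    shift a (weighted L f) m
      ∎

-- Fibonacci numbers of order k

precedingSum-unique : ∀ {f} (W : ℕ → ℕ → ℕ) → (∀ n → W 0 n ≡ 0) → (∀ L → W (suc L) 0 ≡ 0) →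
                      (∀ L n → W (suc L) (suc n) ≡ f n + W L n) → ∀ L n → W L n ≡ precedingSum L f n
precedingSum-unique W W-0 W-z W-s zero    n       = W-0 n
precedingSum-unique W W-0 W-z W-s (suc L) zero    = trans (W-z L) (sym (sum-replicate-zero L))
precedingSum-unique W W-0 W-z W-s (suc L) (suc n) =
  trans (W-s L n) (cong (_ +_) (precedingSum-unique W W-0 W-z W-s L n))

-- The sums F k (n-1) + ⋯ + F k (n-L) from which Defs computes F are private there. After abstracting
-- suc k1, the one in the unfolding of F (suc k1) (suc n) is a pattern, so unification solves window for it.
mutual
  window : ℕ → ℕ → ℕ → ℕ
  window = _

  F-unfold : ∀ k1 n → (n <ᵇ k1) ≡ false → F (suc k1) (suc n) ≡ F (suc k1) n + window (suc k1) k1 n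
  F-unfold k1 n n≮k1 rewrite n≮k1 with suc k1
  ... | k = refl

F-recurrence : ∀ k m → k ≤ m → F k m ≡ precedingSum k (F k) m
F-recurrence zero     m       _          = refl
F-recurrence (suc k1) (suc n) (s≤s k1≤n) =
  trans (F-unfold k1 n (dec-false (n <? k1) (≤⇒≯ k1≤n)))
        (cong (F (suc k1) n +_) (precedingSum-unique (window (suc k1)) (λ _ → refl) (λ _ → refl) (λ _ _ → refl) k1 n))

F-below : ∀ k1 i → i < k1 → F (suc k1) i ≡ 0
F-below k1 i i<k1
  rewrite (i <ᵇ suc k1) ≡ true ∋ dec-true (i <? suc k1) (m<n⇒m<1+n i<k1)
        | (i ≡ᵇ k1) ≡ false ∋ dec-false (i ≟ k1) (<⇒≢ i<k1) = refl

F-one : ∀ k1 → F (suc k1) k1 ≡ 1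
F-one k1
  rewrite (k1 <ᵇ suc k1) ≡ true ∋ dec-true (suc k1 ≤? suc k1) ≤-refl
        | (k1 ≡ᵇ k1) ≡ true ∋ dec-true (k1 ≟ k1) refl = refl

-- Counting strings and edges

length-filter-++ : {P : Pred A ℓ} (P? : Decidable P) (xs ys : List A) →
                   length (filter P? (xs ++ ys)) ≡ length (filter P? xs) + length (filter P? ys)
length-filter-++ P? xs ys = trans (cong length (filter-++ P? xs ys)) (length-++ (filter P? xs))

filter-map : {P : Pred B ℓ} (P? : Decidable P) (f : A → B) (xs : List A) →
             filter P? (map f xs) ≡ map f (filter (P? ∘ f) xs)
filter-map P? f []       = refl
filter-map P? f (x ∷ xs) with does (P? (f x))
... | true  = cong (f x ∷_) (filter-map P? f xs)
... | false = filter-map P? f xs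

length-filter-map : {P : Pred B ℓ} (P? : Decidable P) (f : A → B) (xs : List A) →
                    length (filter P? (map f xs)) ≡ length (filter (P? ∘ f) xs)
length-filter-map P? f xs = trans (cong length (filter-map P? f xs)) (length-map f (filter (P? ∘ f) xs))

atDistance : ℕ → Vec Bool m → List (Vec Bool m) → ℕ
atDistance d x Y = length (filter (λ y → hamming x y ≟ d) Y)

crossPairs : ℕ → List (Vec Bool m) → List (Vec Bool m) → ℕ
crossPairs d []      Y = 0
crossPairs d (x ∷ X) Y = atDistance d x Y + crossPairs d X Y

edges : List (Vec Bool m) → ℕ
edges X = length (filter (λ p → hamming (proj₁ p) (proj₂ p) ≟ 1) (pairs X))

atDistance-same : ∀ b d (x : Vec Bool m) Y → atDistance d (b ∷ x) (map (b ∷_) Y) ≡ atDistance d x Y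
atDistance-same false d x = length-filter-map _ (false ∷_)
atDistance-same true  d x = length-filter-map _ (true ∷_)

atDistance-flip : ∀ b d (x : Vec Bool m) Y → atDistance (suc d) (b ∷ x) (map (not b ∷_) Y) ≡ atDistance d x Y
atDistance-flip false d x Y = trans (length-filter-map _ (true ∷_) Y)
                                    (cong length (filter-≐ _ _ (suc-injective , cong suc) Y))
atDistance-flip true  d x Y = trans (length-filter-map _ (false ∷_) Y)
                                    (cong length (filter-≐ _ _ (suc-injective , cong suc) Y))

atDistance-zero-flip : ∀ b (x : Vec Bool m) Y → atDistance 0 (b ∷ x) (map (not b ∷_) Y) ≡ 0
atDistance-zero-flip false x Y = trans (length-filter-map _ (true ∷_) Y)
                                       (cong length (filter-none _ (universal (λ _ ()) Y)))
atDistance-zero-flip true  x Y = trans (length-filter-map _ (false ∷_) Y)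
                                       (cong length (filter-none _ (universal (λ _ ()) Y)))

crossPairs-++ˡ : ∀ d (X X′ Y : List (Vec Bool m)) → crossPairs d (X ++ X′) Y ≡ crossPairs d X Y + crossPairs d X′ Y
crossPairs-++ˡ d []      X′ Y = refl
crossPairs-++ˡ d (x ∷ X) X′ Y = trans (cong (atDistance d x Y +_) (crossPairs-++ˡ d X X′ Y))
                                      (sym (+-assoc (atDistance d x Y) _ _))

crossPairs-++ʳ : ∀ d (X Y Y′ : List (Vec Bool m)) → crossPairs d X (Y ++ Y′) ≡ crossPairs d X Y + crossPairs d X Y′
crossPairs-++ʳ d []      Y Y′ = refl
crossPairs-++ʳ d (x ∷ X) Y Y′ = begin
  atDistance d x (Y ++ Y′) + crossPairs d X (Y ++ Y′)
    ≡⟨ cong₂ _+_ (length-filter-++ (λ y → hamming x y ≟ d) Y Y′) (crossPairs-++ʳ d X Y Y′) ⟩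
  (atDistance d x Y + atDistance d x Y′) + (crossPairs d X Y + crossPairs d X Y′)
    ≡⟨ +-interchange (atDistance d x Y) _ _ _ ⟩
  (atDistance d x Y + crossPairs d X Y) + (atDistance d x Y′ + crossPairs d X Y′) ∎
  where open ≡-Reasoning

crossPairs-same : ∀ b d (X Y : List (Vec Bool m)) → crossPairs d (map (b ∷_) X) (map (b ∷_) Y) ≡ crossPairs d X Y
crossPairs-same b d []      Y = refl
crossPairs-same b d (x ∷ X) Y = cong₂ _+_ (atDistance-same b d x Y) (crossPairs-same b d X Y)

crossPairs-flip : ∀ b d (X Y : List (Vec Bool m)) → crossPairs (suc d) (map (b ∷_) X) (map (not b ∷_) Y) ≡ crossPairs d X Y
crossPairs-flip b d []      Y = refl
crossPairs-flip b d (x ∷ X) Y = cong₂ _+_ (atDistance-flip b d x Y) (crossPairs-flip b d X Y)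

crossPairs-zero-flip : ∀ b (X Y : List (Vec Bool m)) → crossPairs 0 (map (b ∷_) X) (map (not b ∷_) Y) ≡ 0
crossPairs-zero-flip b []      Y = refl
crossPairs-zero-flip b (x ∷ X) Y = cong₂ _+_ (atDistance-zero-flip b x Y) (crossPairs-zero-flip b X Y)

edges-∷ : ∀ (x : Vec Bool m) X → edges (x ∷ X) ≡ atDistance 1 x X + edges X
edges-∷ x X = trans (length-filter-++ _ (map (x ,_) X) (pairs X))
                    (cong (_+ edges X) (length-filter-map _ (x ,_) X))

edges-++ : ∀ (X Y : List (Vec Bool m)) → edges (X ++ Y) ≡ edges X + edges Y + crossPairs 1 X Y
edges-++ []      Y = sym (+-identityʳ (edges Y))
edges-++ (x ∷ X) Y = begin
  edges (x ∷ X ++ Y)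
    ≡⟨ edges-∷ x (X ++ Y) ⟩
  atDistance 1 x (X ++ Y) + edges (X ++ Y)
    ≡⟨ cong₂ _+_ (length-filter-++ (λ y → hamming x y ≟ 1) X Y) (edges-++ X Y) ⟩
  (atDistance 1 x X + atDistance 1 x Y) + (edges X + edges Y + crossPairs 1 X Y)
    ≡⟨ regroup (atDistance 1 x X) (atDistance 1 x Y) (edges X) (edges Y) (crossPairs 1 X Y) ⟩
  (atDistance 1 x X + edges X) + edges Y + (atDistance 1 x Y + crossPairs 1 X Y)
    ≡⟨ cong (λ e → e + edges Y + crossPairs 1 (x ∷ X) Y) (edges-∷ x X) ⟨
  edges (x ∷ X) + edges Y + crossPairs 1 (x ∷ X) Y ∎
  where
  open ≡-Reasoning
  regroup : ∀ a b c d e → (a + b) + (c + d + e) ≡ (a + c) + d + (b + e)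
  regroup = solve-∀

edges-map : ∀ b (X : List (Vec Bool m)) → edges (map (b ∷_) X) ≡ edges X
edges-map b []      = refl
edges-map b (x ∷ X) = begin
  edges (map (b ∷_) (x ∷ X))                                   ≡⟨ edges-∷ (b ∷ x) (map (b ∷_) X) ⟩
  atDistance 1 (b ∷ x) (map (b ∷_) X) + edges (map (b ∷_) X)   ≡⟨ cong₂ _+_ (atDistance-same b 1 x X) (edges-map b X) ⟩
  atDistance 1 x X + edges X                                   ≡⟨ edges-∷ x X ⟨
  edges (x ∷ X)                                                ∎
  where open ≡-Reasoning

select : (m : ℕ) → (Vec Bool m → Bool) → List (Vec Bool m)
select m p = filter (λ v → p v Bool.≟ true) (allStrings m)

select-cong : ∀ m {p q : Vec Bool m → Bool} → (∀ v → p v ≡ q v) → select m p ≡ select m q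
select-cong m p≗q = filter-≐ _ _ ((λ {v} → trans (sym (p≗q v))) , (λ {v} → trans (p≗q v))) (allStrings m)

select-suc : ∀ m (p : Vec Bool (suc m) → Bool) →
             select (suc m) p ≡ map (false ∷_) (select m (p ∘ (false ∷_))) ++ map (true ∷_) (select m (p ∘ (true ∷_)))
select-suc m p = trans (filter-++ P? (map (false ∷_) strings) (map (true ∷_) strings))
                       (cong₂ _++_ (filter-map P? (false ∷_) strings) (filter-map P? (true ∷_) strings))
  where
  strings = allStrings m
  P? = λ v → p v Bool.≟ true

length-select-suc : ∀ m (p : Vec Bool (suc m) → Bool) →
                    length (select (suc m) p) ≡ length (select m (p ∘ (false ∷_))) + length (select m (p ∘ (true ∷_)))
length-select-suc m p = begin
  length (select (suc m) p)                                ≡⟨ cong length (select-suc m p) ⟩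
  length (map (false ∷_) P₀ ++ map (true ∷_) P₁)           ≡⟨ length-++ (map (false ∷_) P₀) ⟩
  length (map (false ∷_) P₀) + length (map (true ∷_) P₁)   ≡⟨ cong₂ _+_ (length-map (false ∷_) P₀) (length-map (true ∷_) P₁) ⟩
  length P₀ + length P₁                                    ∎
  where
  open ≡-Reasoning
  P₀ = select m (p ∘ (false ∷_))
  P₁ = select m (p ∘ (true ∷_))

-- Every string occurs exactly once in allStrings m, so equal pairs across two selections are counted once each.
crossPairs-select : ∀ m (p q : Vec Bool m → Bool) →
                    crossPairs 0 (select m p) (select m q) ≡ length (select m (λ v → p v ∧ q v))
crossPairs-select zero p q with p [] | q []
... | false | _     = refl
... | true  | false = refl
... | true  | true  = refl
crossPairs-select (suc m) p q = begin
  crossPairs 0 (select (suc m) p) (select (suc m) q)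
    ≡⟨ cong₂ (crossPairs 0) (select-suc m p) (select-suc m q) ⟩
  crossPairs 0 (map f₀ P₀ ++ map f₁ P₁) (map f₀ Q₀ ++ map f₁ Q₁)
    ≡⟨ crossPairs-++ˡ 0 (map f₀ P₀) (map f₁ P₁) _ ⟩
  crossPairs 0 (map f₀ P₀) (map f₀ Q₀ ++ map f₁ Q₁) + crossPairs 0 (map f₁ P₁) (map f₀ Q₀ ++ map f₁ Q₁)
    ≡⟨ cong₂ _+_ (crossPairs-++ʳ 0 (map f₀ P₀) (map f₀ Q₀) _) (crossPairs-++ʳ 0 (map f₁ P₁) (map f₀ Q₀) _) ⟩
  (crossPairs 0 (map f₀ P₀) (map f₀ Q₀) + crossPairs 0 (map f₀ P₀) (map f₁ Q₁))
    + (crossPairs 0 (map f₁ P₁) (map f₀ Q₀) + crossPairs 0 (map f₁ P₁) (map f₁ Q₁))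
    ≡⟨ cong₂ _+_ (cong₂ _+_ (crossPairs-same false 0 P₀ Q₀) (crossPairs-zero-flip false P₀ Q₁))
                 (cong₂ _+_ (crossPairs-zero-flip true P₁ Q₀) (crossPairs-same true 0 P₁ Q₁)) ⟩
  (crossPairs 0 P₀ Q₀ + 0) + crossPairs 0 P₁ Q₁
    ≡⟨ cong₂ _+_ (trans (+-identityʳ _) (crossPairs-select m _ _)) (crossPairs-select m _ _) ⟩
  length (select m (pq ∘ f₀)) + length (select m (pq ∘ f₁))
    ≡⟨ length-select-suc m pq ⟨
  length (select (suc m) pq) ∎
  where
  open ≡-Reasoning
  f₀ f₁ : Vec Bool m → Vec Bool (suc m)
  f₀ = false ∷_
  f₁ = true ∷_
  P₀ = select m (p ∘ f₀)
  P₁ = select m (p ∘ f₁)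
  Q₀ = select m (q ∘ f₀)
  Q₁ = select m (q ∘ f₁)
  pq = λ v → p v ∧ q v

≤ᵇ-true : ∀ {k c} → k ≤ c → (k ≤ᵇ c) ≡ true
≤ᵇ-true {k} {c} = dec-true (k ≤? c)

≤ᵇ-false : ∀ {k c} → c < k → (k ≤ᵇ c) ≡ false
≤ᵇ-false {k} {c} c<k = dec-false (k ≤? c) (<⇒≱ c<k)

≤ᵇ-mono : ∀ k {c d} → c ≤ d → T (k ≤ᵇ c) → T (k ≤ᵇ d)
≤ᵇ-mono k {c} c≤d = ≤⇒≤ᵇ ∘ (λ k≤c → ≤-trans k≤c c≤d) ∘ ≤ᵇ⇒≤ k c

T-∨-map : ∀ {x x′ y y′} → (T x → T x′) → (T y → T y′) → T (x ∨ y) → T (x′ ∨ y′)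
T-∨-map f g = Equivalence.from Bool.T-∨ ∘ Sum.map f g ∘ Equivalence.to Bool.T-∨

not-∧-absorb : ∀ {x y} → (T x → T y) → not x ∧ not y ≡ not y
not-∧-absorb {false}        _   = refl
not-∧-absorb {true} {true}  _   = refl
not-∧-absorb {true} {false} x⇒y = ⊥-elim (x⇒y _)

hasRun-≥ : ∀ k {c} (v : Vec Bool m) → k ≤ c → hasRun k c v ≡ true
hasRun-≥ k         []          k≤c = ≤ᵇ-true k≤c
hasRun-≥ k         (false ∷ v) k≤c = cong (_∨ hasRun k 0 v) (≤ᵇ-true k≤c)
hasRun-≥ k {c}     (true ∷ v)  k≤c = cong (_∨ hasRun k (suc c) v) (≤ᵇ-true k≤c)

hasRun-mono : ∀ k {c d} (v : Vec Bool m) → c ≤ d → T (hasRun k c v) → T (hasRun k d v)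
hasRun-mono k []          c≤d = ≤ᵇ-mono k c≤d
hasRun-mono k (false ∷ v) c≤d = T-∨-map (≤ᵇ-mono k c≤d) id
hasRun-mono k (true ∷ v)  c≤d = T-∨-map (≤ᵇ-mono k c≤d) (hasRun-mono k v (s≤s c≤d))

afterRun : ℕ → ℕ → (m : ℕ) → List (Vec Bool m)
afterRun k c m = select m (λ v → not (hasRun k c v))

afterRun-zero : ∀ {k c} → c < k → afterRun k c 0 ≡ [] ∷ []
afterRun-zero c<k rewrite ≤ᵇ-false c<k = refl

afterRun-saturated : ∀ k m → afterRun k k m ≡ []
afterRun-saturated k m =
  filter-none _ (universal (λ v → (λ ()) ∘ trans (cong not (sym (hasRun-≥ k v ≤-refl)))) (allStrings m))

afterRun-suc : ∀ {k c} m → c < k →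
               afterRun k c (suc m) ≡ map (false ∷_) (afterRun k 0 m) ++ map (true ∷_) (afterRun k (suc c) m)
afterRun-suc {k} {c} m c<k = trans (select-suc m _) (cong₂ (λ X Y → map (false ∷_) X ++ map (true ∷_) Y)
  (select-cong m (λ v → cong (λ b → not (b ∨ hasRun k 0 v)) (≤ᵇ-false c<k)))
  (select-cong m (λ v → cong (λ b → not (b ∨ hasRun k (suc c) v)) (≤ᵇ-false c<k))))

length-afterRun-suc : ∀ {k c} m → c < k →
                      length (afterRun k c (suc m)) ≡ length (afterRun k 0 m) + length (afterRun k (suc c) m)
length-afterRun-suc {k} {c} m c<k = begin
  length (afterRun k c (suc m))                          ≡⟨ cong length (afterRun-suc m c<k) ⟩
  length (map (false ∷_) V₀ ++ map (true ∷_) V₁)         ≡⟨ length-++ (map (false ∷_) V₀) ⟩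
  length (map (false ∷_) V₀) + length (map (true ∷_) V₁) ≡⟨ cong₂ _+_ (length-map (false ∷_) V₀) (length-map (true ∷_) V₁) ⟩
  length V₀ + length V₁                                  ∎
  where
  open ≡-Reasoning
  V₀ = afterRun k 0 m
  V₁ = afterRun k (suc c) m

edges-afterRun-suc : ∀ {k c} m → c < k →
  edges (afterRun k c (suc m)) ≡ edges (afterRun k 0 m) + edges (afterRun k (suc c) m) + length (afterRun k (suc c) m)
edges-afterRun-suc {k} {c} m c<k = begin
  edges (afterRun k c (suc m))
    ≡⟨ cong edges (afterRun-suc m c<k) ⟩
  edges (map (false ∷_) V₀ ++ map (true ∷_) V₁)
    ≡⟨ edges-++ (map (false ∷_) V₀) (map (true ∷_) V₁) ⟩
  edges (map (false ∷_) V₀) + edges (map (true ∷_) V₁) + crossPairs 1 (map (false ∷_) V₀) (map (true ∷_) V₁)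
    ≡⟨ cong₂ _+_ (cong₂ _+_ (edges-map false V₀) (edges-map true V₁)) (crossPairs-flip false 0 V₀ V₁) ⟩
  edges V₀ + edges V₁ + crossPairs 0 V₀ V₁
    ≡⟨ cong (edges V₀ + edges V₁ +_) (crossPairs-select m _ _) ⟩
  edges V₀ + edges V₁ + length (select m (λ v → not (hasRun k 0 v) ∧ not (hasRun k (suc c) v)))
    ≡⟨ cong (λ X → edges V₀ + edges V₁ + length X) (select-cong m (λ v → not-∧-absorb (hasRun-mono k v z≤n))) ⟩
  edges V₀ + edges V₁ + length V₁ ∎
  where
  open ≡-Reasoning
  V₀ = afterRun k 0 m
  V₁ = afterRun k (suc c) m

-- Closed forms

RunRecurrence : ℕ → (ℕ → ℕ → ℕ) → (ℕ → ℕ → ℕ) → Set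
RunRecurrence k g X = ∀ c m → c < k → X c (suc m) ≡ X 0 m + X (suc c) m + g c m

module _ {k g} {X Y : ℕ → ℕ → ℕ} (recX : RunRecurrence k g X) (recY : RunRecurrence k g Y)
         (saturated : ∀ m → X k m ≡ Y k m) (initial : ∀ c → c < k → X c 0 ≡ Y c 0) where

  runRecurrence-unique : ∀ m c → c ≤ k → X c m ≡ Y c m
  runRecurrence-unique m c c≤k with m≤n⇒m<n∨m≡n c≤k
  runRecurrence-unique m       c _ | inj₂ refl = saturated m
  runRecurrence-unique zero    c _ | inj₁ c<k  = initial c c<k
  runRecurrence-unique (suc m) c _ | inj₁ c<k  = begin
    X c (suc m)                  ≡⟨ recX c m c<k ⟩
    X 0 m + X (suc c) m + g c m  ≡⟨ cong₂ (λ x y → x + y + g c m) (runRecurrence-unique m 0 z≤n)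
                                                                 (runRecurrence-unique m (suc c) c<k) ⟩
    Y 0 m + Y (suc c) m + g c m  ≡⟨ recY c m c<k ⟨
    Y c (suc m)                  ∎
    where open ≡-Reasoning

Σ-step : ∀ f {a b} → a ≤ b → Σ[ a ⋯ b ] f ≡ f a + Σ[ suc a ⋯ b ] f
Σ-step f a≤b rewrite +-∸-assoc 1 a≤b = refl

Σ-empty : ∀ f {a b} → b < a → Σ[ a ⋯ b ] f ≡ 0
Σ-empty f b<a rewrite m≤n⇒m∸n≡0 b<a = refl

Σ-as-∑ : ∀ f a b m → suc b ≡ m + a → Σ[ a ⋯ b ] f ≡ ∑[ i < m ] f (toℕ i + a)
Σ-as-∑ f a b zero    b+1≡a = Σ-empty f (≤-reflexive b+1≡a)
Σ-as-∑ f a b (suc m) eq    = begin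
  Σ[ a ⋯ b ] f                          ≡⟨ Σ-step f (subst (a ≤_) (sym (suc-injective eq)) (m≤n+m a m)) ⟩
  f a + Σ[ suc a ⋯ b ] f                ≡⟨ cong (f a +_) (Σ-as-∑ f (suc a) b m (trans eq (sym (+-suc m a)))) ⟩
  f a + ∑[ i < m ] f (toℕ i + suc a)    ≡⟨ cong (f a +_) (sum-cong-≗ {m} (λ i → cong f (+-suc (toℕ i) a))) ⟩
  f a + ∑[ i < m ] f (suc (toℕ i + a))  ∎
  where open ≡-Reasoning

module Order (k1 : ℕ) where

  k : ℕ
  k = suc k1

  H : ℕ → ℕ
  H m = F k (m + k1)

  H-recurrence : H ≗ λ m → δ m + precedingSum k H m
  H-recurrence zero    = trans (F-one k1) (cong suc (sym (sum-replicate-zero k)))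
  H-recurrence (suc m) = trans (F-recurrence k (suc m + k1) (s≤s (m≤n+m k1 m)))
                               (sum-cong-≗ {k} (λ a → shift-offset (suc (toℕ a)) (F k) (F-below k1) (suc m)))

  C : ℕ → ℕ
  C = H ⋆ H

  C-recurrence : C ≗ λ m → H m + precedingSum k C m
  C-recurrence m = trans (IsShiftLinear.recurrence-homo (⋆-isShiftLinear H) k {g = δ} H-recurrence m)
                         (cong (_+ precedingSum k C m) (δ-⋆ H m))

  R : ℕ → ℕ
  R = weighted k C

  R-recurrence : R ≗ λ m → weighted k H m + precedingSum k R m
  R-recurrence = IsShiftLinear.recurrence-homo (weighted-isShiftLinear k) k {g = H} C-recurrence

  sizeFormula : ℕ → ℕ → ℕ
  sizeFormula c m = ∑[ a < k ∸ c ] shift (toℕ a) H m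

  edgesFormula : ℕ → ℕ → ℕ
  edgesFormula c m = weighted (k ∸ c) H m + precedingSum (k ∸ c) R m

  sizeFormula-recurrence : RunRecurrence k (λ _ _ → 0) sizeFormula
  sizeFormula-recurrence c m (s≤s c≤k1) rewrite +-∸-assoc 1 c≤k1 =
    trans (cong (_+ sizeFormula (suc c) m) (H-recurrence (suc m))) (sym (+-identityʳ _))

  edgesFormula-recurrence : RunRecurrence k (λ c m → sizeFormula (suc c) m) edgesFormula
  edgesFormula-recurrence c m (s≤s c≤k1) rewrite +-∸-assoc 1 c≤k1 = begin
    ∑[ j < L ] (shift (toℕ j) H m + toℕ j * shift (toℕ j) H m) + (R m + precedingSum L R m)
      ≡⟨ cong (_+ (R m + precedingSum L R m))
              (∑-distrib-+ {L} (λ j → shift (toℕ j) H m) (λ j → toℕ j * shift (toℕ j) H m)) ⟩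
    (sizeFormula (suc c) m + weighted L H m) + (R m + precedingSum L R m)
      ≡⟨ regroup (sizeFormula (suc c) m) (weighted L H m) (R m) (precedingSum L R m) ⟩
    R m + (weighted L H m + precedingSum L R m) + sizeFormula (suc c) m
      ≡⟨ cong (λ r → r + edgesFormula (suc c) m + sizeFormula (suc c) m) (R-recurrence m) ⟩
    edgesFormula 0 m + edgesFormula (suc c) m + sizeFormula (suc c) m ∎
    where
    open ≡-Reasoning
    L = k1 ∸ c
    regroup : ∀ s w r p → (s + w) + (r + p) ≡ r + (w + p) + s
    regroup = solve-∀

  sizeFormula-saturated : ∀ m → sizeFormula k m ≡ 0
  sizeFormula-saturated m rewrite n∸n≡0 k1 = refl

  sizeFormula-initial : ∀ c → c < k → sizeFormula c 0 ≡ 1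
  sizeFormula-initial c (s≤s c≤k1) rewrite +-∸-assoc 1 c≤k1 = cong₂ _+_ (F-one k1) (sum-replicate-zero (k1 ∸ c))

  edgesFormula-saturated : ∀ m → edgesFormula k m ≡ 0
  edgesFormula-saturated m rewrite n∸n≡0 k1 = refl

  edgesFormula-initial : ∀ c → edgesFormula c 0 ≡ 0
  edgesFormula-initial c = cong₂ _+_ (weighted-at-zero (k ∸ c) H) (sum-replicate-zero (k ∸ c))

  size-afterRun : ∀ m c → c ≤ k → length (afterRun k c m) ≡ sizeFormula c m
  size-afterRun = runRecurrence-unique
    (λ c m c<k → trans (length-afterRun-suc m c<k) (sym (+-identityʳ _)))
    sizeFormula-recurrence
    (λ m → trans (cong length (afterRun-saturated k m)) (sym (sizeFormula-saturated m)))
    (λ c c<k → trans (cong length (afterRun-zero c<k)) (sym (sizeFormula-initial c c<k)))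

  edges-afterRun : ∀ m c → c ≤ k → edges (afterRun k c m) ≡ edgesFormula c m
  edges-afterRun = runRecurrence-unique
    (λ c m c<k → trans (edges-afterRun-suc m c<k)
                       (cong (edges (afterRun k 0 m) + edges (afterRun k (suc c) m) +_) (size-afterRun m (suc c) c<k)))
    edgesFormula-recurrence
    (λ m → trans (cong edges (afterRun-saturated k m)) (sym (edgesFormula-saturated m)))
    (λ c c<k → trans (cong edges (afterRun-zero c<k)) (sym (edgesFormula-initial c)))

  productTerm : ℕ → ℕ → ℕ → ℕ
  productTerm n j i = F k i * F k (n + 2 * k ∸ 2 ∸ j ∸ i)

  upper-≤ : ∀ j p → (j + p) + k ∸ 1 ∸ j ≡ p + k1
  upper-≤ j p rewrite +-suc (j + p) k1 | +-assoc j p k1 = m+n∸m≡n j (p + k1)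

  upper-< : 1 ≤ k1 → ∀ {n j} → n < j → n + k ∸ 1 ∸ j < k1
  upper-< (s≤s {n = k2} z≤n) {n} {j} n<j rewrite +-suc n (suc k2) | +-suc n k2 =
    s≤s (≤-trans (∸-monoʳ-≤ (suc (n + k2)) n<j) (≤-reflexive (m+n∸m≡n n k2)))

  index-≤ : ∀ j p i → i ≤ p → (j + p) + 2 * k ∸ 2 ∸ j ∸ (i + k1) ≡ (p ∸ i) + k1
  index-≤ j p i i≤p = begin
    (j + p) + 2 * k ∸ 2 ∸ j ∸ (i + k1)
      ≡⟨ cong (λ x → (j + x) + 2 * k ∸ 2 ∸ j ∸ (i + k1)) (sym (m+[n∸m]≡n i≤p)) ⟩
    (j + (i + q)) + 2 * k ∸ 2 ∸ j ∸ (i + k1)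
      ≡⟨ cong (λ x → x ∸ 2 ∸ j ∸ (i + k1)) (expand j i q k1) ⟩
    j + ((i + k1) + (q + k1)) ∸ j ∸ (i + k1)
      ≡⟨ cong (_∸ (i + k1)) (m+n∸m≡n j ((i + k1) + (q + k1))) ⟩
    (i + k1) + (q + k1) ∸ (i + k1)
      ≡⟨ m+n∸m≡n (i + k1) (q + k1) ⟩
    q + k1 ∎
    where
    open ≡-Reasoning
    q = p ∸ i
    expand : ∀ j i q k1 → (j + (i + q)) + 2 * suc k1 ≡ 2 + (j + ((i + k1) + (q + k1)))
    expand = solve-∀

  product-sum-≤ : ∀ j p → Σ[ k ∸ 1 ⋯ (j + p) + k ∸ 1 ∸ j ] (productTerm (j + p) j) ≡ C p
  product-sum-≤ j p = begin
    Σ[ k1 ⋯ (j + p) + k ∸ 1 ∸ j ] (productTerm (j + p) j)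
      ≡⟨ Σ-as-∑ _ k1 _ (suc p) (cong suc (upper-≤ j p)) ⟩
    ∑[ i < suc p ] productTerm (j + p) j (toℕ i + k1)
      ≡⟨ sum-cong-≗ {suc p} (λ i → cong (λ x → H (toℕ i) * F k x) (index-≤ j p (toℕ i) (≤-pred (toℕ<n i)))) ⟩
    C p ∎
    where open ≡-Reasoning

  product-sum : 1 ≤ k1 → ∀ n j → Σ[ k ∸ 1 ⋯ n + k ∸ 1 ∸ j ] (productTerm n j) ≡ shift j C n
  product-sum 1≤k1 n j with j ≤? n
  ... | no  j≰n = trans (Σ-empty _ (upper-< 1≤k1 (≰⇒> j≰n))) (sym (shift-below j C (≰⇒> j≰n)))
  ... | yes j≤n = subst (λ n → Σ[ k ∸ 1 ⋯ n + k ∸ 1 ∸ j ] (productTerm n j) ≡ shift j C n) (m+[n∸m]≡n j≤n)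
                        (trans (product-sum-≤ j (n ∸ j)) (sym (shift-at j C (n ∸ j))))

  R-as-Σ : 1 ≤ k1 → ∀ n → R n ≡ Σ[ 1 ⋯ k1 ] (λ j → j * Σ[ k ∸ 1 ⋯ n + k ∸ 1 ∸ j ] (productTerm n j))
  R-as-Σ 1≤k1 n = sym (trans (Σ-as-∑ g 1 k1 k1 (+-comm 1 k1)) (sum-cong-≗ {k1} λ j →
    trans (cong g (+-comm (toℕ j) 1)) (cong (suc (toℕ j) *_) (product-sum 1≤k1 n (suc (toℕ j))))))
    where
    g : ℕ → ℕ
    g j = j * Σ[ k ∸ 1 ⋯ n + k ∸ 1 ∸ j ] (productTerm n j)

theorem3p2 : (k n : ℕ) → 2 ≤ k → 1 ≤ n →
    edgeCount k n ≡ Σ[ 1 ⋯ k ∸ 1 ] (λ j → j * Σ[ k ∸ 1 ⋯ n + k ∸ 1 ∸ j ] (λ i → F k i * F k (n + 2 * k ∸ 2 ∸ j ∸ i)))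
theorem3p2 (suc k1) n (s≤s 1≤k1) _ = begin
  edgeCount k n     ≡⟨ edges-afterRun n 0 z≤n ⟩
  edgesFormula 0 n  ≡⟨ R-recurrence n ⟨
  R n               ≡⟨ R-as-Σ 1≤k1 n ⟩
  Σ[ 1 ⋯ k1 ] (λ j → j * Σ[ k1 ⋯ n + k ∸ 1 ∸ j ] (λ i → F k i * F k (n + 2 * k ∸ 2 ∸ j ∸ i))) ∎
  where
  open ≡-Reasoning
  open Order k1
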